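{- Let $G$ be a 2-connected graph and let $H:V(G)\to 2^{\mathbb{N}}$ be such that $(G,H)$ is dense. Then $G$ has no $H$-orientation if and only if every vertex $x\in V(G)$ has fixed parity and $|\{x\in V(G): H(x)\text{ is odd}\}|\not\equiv e(G)\pmod 2$.
   Context: $G$ has no loops; $e(G)=|E(G)|$. An $H$-orientation is an orientation $O$ of $G$ with out-degree $d^+_O(v)\in H(v)$ for all $v$. The pair $(G,H)$ is dense if $G$ is connected and for every $v\in V(G)$ and every integer $i$ with $0\le i\le d_G(v)-1$: if $i\notin H(v)$ then $i+1\in H(v)$. $H(x)$ is odd (resp. even) if $H(x)\cap[0,d_G(x)]$ is nonempty and consists only of odd (resp. even) integers; $x$ has fixed parity if $H(x)$ is odd or even. -}

module Defs where

open import Data.Nat using (ℕ; zero; suc; _+_; _<_; _≤_; _%_)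
open import Data.Nat.Properties using () renaming (_≟_ to _≟ℕ_)
open import Data.Fin using (Fin; toℕ; _≟_)
import Data.Fin as F
open import Data.Fin.Properties using (any?; all?)
open import Data.Bool using (Bool; true; false; if_then_else_)
open import Data.Product using (Σ; _×_; _,_; proj₁; proj₂; ∃)
open import Data.Sum using (_⊎_; inj₁; inj₂)
open import Relation.Nullary using (¬_; Dec; yes; no)
open import Relation.Nullary.Decidable using (⌊_⌋; _×-dec_; _→-dec_)
open import Relation.Binary.PropositionalEquality using (_≡_; _≢_)
open import Data.Bool.Properties using () renaming (_≟_ to _≟B_)

record Graph : Set where
  field
    n      : ℕ
    m      : ℕ
    ends   : Fin m → Fin n × Fin n
    noLoop : ∀ e → proj₁ (ends e) ≢ proj₂ (ends e)

open Graph public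

Assignment : Graph → Set
Assignment G = Fin (n G) → ℕ → Bool

countB : {k : ℕ} → (Fin k → Bool) → ℕ
countB {zero}  b = 0
countB {suc k} b = (if b F.zero then 1 else 0) + countB (λ i → b (F.suc i))

e : Graph → ℕ
e G = m G

deg : (G : Graph) → Fin (n G) → ℕ
deg G v = countB (λ ed → ⌊ proj₁ (ends G ed) ≟ v ⌋ Data.Bool.∨ ⌊ proj₂ (ends G ed) ≟ v ⌋)
  where import Data.Bool

-- Orientation: O ed = true means ed is directed from proj₁ to proj₂.
Orientation : Graph → Set
Orientation G = Fin (m G) → Bool

tail : (G : Graph) → Orientation G → Fin (m G) → Fin (n G)
tail G O ed = if O ed then proj₁ (ends G ed) else proj₂ (ends G ed)

outdeg : (G : Graph) → Orientation G → Fin (n G) → ℕ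
outdeg G O v = countB (λ ed → ⌊ tail G O ed ≟ v ⌋)

IsHOrientation : (G : Graph) → Assignment G → Orientation G → Set
IsHOrientation G H O = ∀ v → H v (outdeg G O v) ≡ true

Adjacent : (G : Graph) → Fin (n G) → Fin (n G) → Set
Adjacent G u v = Σ (Fin (m G)) λ ed → (ends G ed ≡ (u , v)) ⊎ (ends G ed ≡ (v , u))

data Reach (G : Graph) (allowed : Fin (n G) → Set) : Fin (n G) → Fin (n G) → Set where
  here : ∀ {u} → allowed u → Reach G allowed u u
  step : ∀ {u w v} → allowed u → Adjacent G u w → Reach G allowed w v → Reach G allowed u v

Connected : Graph → Set
Connected G = ∀ u v → Reach G (λ _ → Data.Unit.⊤) u v
  where import Data.Unit

TwoConnected : Graph → Set
TwoConnected G = (3 ≤ n G) × (∀ w u v → u ≢ w → v ≢ w → Reach G (λ x → x ≢ w) u v)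

Dense : (G : Graph) → Assignment G → Set
Dense G H = Connected G ×
  (∀ v i → i < deg G v → H v i ≡ false → H v (suc i) ≡ true)

OddN : ℕ → Set
OddN i = i % 2 ≡ 1

EvenN : ℕ → Set
EvenN i = i % 2 ≡ 0

HOdd : (G : Graph) → Assignment G → Fin (n G) → Set
HOdd G H x = (∃ λ (i : Fin (suc (deg G x))) → H x (toℕ i) ≡ true)
           × (∀ (i : Fin (suc (deg G x))) → H x (toℕ i) ≡ true → OddN (toℕ i))

HEven : (G : Graph) → Assignment G → Fin (n G) → Set
HEven G H x = (∃ λ (i : Fin (suc (deg G x))) → H x (toℕ i) ≡ true)
            × (∀ (i : Fin (suc (deg G x))) → H x (toℕ i) ≡ true → EvenN (toℕ i))

FixedParity : (G : Graph) → Assignment G → Fin (n G) → Set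
FixedParity G H x = HOdd G H x ⊎ HEven G H x

HOdd? : (G : Graph) (H : Assignment G) (x : Fin (n G)) → Dec (HOdd G H x)
HOdd? G H x = any? (λ i → H x (toℕ i) ≟B true)
        ×-dec all? (λ i → (H x (toℕ i) ≟B true) →-dec ((toℕ i % 2) ≟ℕ 1))

numOdd : (G : Graph) → Assignment G → ℕ
numOdd G H = countB (λ x → ⌊ HOdd? G H x ⌋)

module Submission where

-- Reversing an edge changes the out-degrees of its two ends by one, so by density a vertex whose
-- out-degree misses H becomes satisfied when an edge at it is reversed. Pushing such a defect along
-- a path (the number of unsatisfied vertices strictly drops) satisfies every vertex but a chosen root.
-- If some H(x) contains k and k + 1 with k < d(x), orient k of the edges at x other than an edge xy
-- away from x and repair G − x, which is connected, towards y; reversing xy if y is still unsatisfied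
-- keeps the out-degree of x in {k, k + 1}. Otherwise density makes every H(x) ∩ [0, d(x)] alternate,
-- so every vertex has fixed parity. Out-degrees sum to e(G), so an H-orientation forces the number of
-- odd vertices to have the parity of e(G); conversely, under that condition the same count shows that
-- the orientation repaired towards any root is correct at the root as well.

open import Defs
open import Data.Bool using (Bool; true; false; not; _∧_; _∨_; _xor_; if_then_else_)
open import Data.Bool.Properties
  using (not-involutive; not-distribˡ-xor; not-distribʳ-xor; xor-identityʳ; ¬-not; ∧-conicalˡ;
         ∧-zeroʳ; ∧-identityʳ; ∨-zeroʳ)
  renaming (_≟_ to _≟ᵇ_)
open import Data.Empty using (⊥-elim)
open import Data.Fin as F using (Fin; _≟_; toℕ; fromℕ<)
open import Data.Fin.Properties using (any?; suc-injective; toℕ≤pred[n]; toℕ-fromℕ<)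
open import Data.Nat using (ℕ; zero; suc; _+_; _%_; _≤_; _<_; z≤n; s≤s; s≤s⁻¹)
open import Data.Nat.Induction using (<-wellFounded)
open import Data.Nat.Properties
  using (anyUpTo?; <⇒≤; n≤1+n; ≤-refl; ≤-reflexive; ≤-trans; +-mono-≤; +-mono-≤-<; +-comm; +-assoc;
         +-cancelʳ-≡; +-identityʳ; +-0-commutativeMonoid; +-commutativeSemigroup)
open import Algebra.Properties.CommutativeMonoid.Sum +-0-commutativeMonoid using (sum; ∑-comm; sum-cong-≗)
open import Algebra.Properties.CommutativeSemigroup +-commutativeSemigroup using (xy∙z≈zy∙x; xy∙z≈xz∙y)
open import Data.Product using (Σ; ∃; _×_; _,_; proj₁; proj₂)
open import Data.Sum using (_⊎_; inj₁; inj₂; [_,_])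
open import Data.Unit using (⊤; tt)
open import Data.Vec.Functional using (_∷_; updateAt)
open import Data.Vec.Functional.Properties using (updateAt-updates; updateAt-minimal)
open import Function using (_∘_; id; case_of_)
open import Function.Bundles using (_⇔_; mk⇔; Equivalence)
open import Induction.WellFounded using (Acc; acc)
open import Relation.Binary.PropositionalEquality
  using (_≡_; _≢_; refl; sym; trans; cong; cong₂; subst; module ≡-Reasoning)
open import Relation.Nullary using (¬_; Dec; yes; no; ¬?)
open import Relation.Nullary.Decidable using (⌊_⌋; _×-dec_)

-- Counting

⌊⌋-yes : ∀ {a} {A : Set a} (a? : Dec A) → A → ⌊ a? ⌋ ≡ true
⌊⌋-yes (yes _) _ = refl
⌊⌋-yes (no ¬a) a = ⊥-elim (¬a a)

⌊⌋-no : ∀ {a} {A : Set a} (a? : Dec A) → ¬ A → ⌊ a? ⌋ ≡ false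
⌊⌋-no (yes a) ¬a = ⊥-elim (¬a a)
⌊⌋-no (no _) _ = refl

⌊⌋-sound : ∀ {a} {A : Set a} (a? : Dec A) → ⌊ a? ⌋ ≡ true → A
⌊⌋-sound (yes a) _ = a

𝟙 : Bool → ℕ
𝟙 b = if b then 1 else 0

𝟙-injective : ∀ {a b} → 𝟙 a ≡ 𝟙 b → a ≡ b
𝟙-injective {false} {false} _ = refl
𝟙-injective {true} {true} _ = refl

𝟙-mono : ∀ {a b} → (a ≡ true → b ≡ true) → 𝟙 a ≤ 𝟙 b
𝟙-mono {false} _ = z≤n
𝟙-mono {true} a⇒b rewrite a⇒b refl = ≤-refl

∧-⊆ : ∀ {a b} → (b ≡ true → a ≡ true) → a ∧ b ≡ b
∧-⊆ {b = false} _ = ∧-zeroʳ _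
∧-⊆ {b = true} b⇒a rewrite b⇒a refl = refl

_⊆ᵇ_ : ∀ {k} → (Fin k → Bool) → (Fin k → Bool) → Set
b ⊆ᵇ c = ∀ i → b i ≡ true → c i ≡ true

countB-cong : ∀ {k} {b c : Fin k → Bool} → (∀ i → b i ≡ c i) → countB b ≡ countB c
countB-cong {zero} _ = refl
countB-cong {suc k} b≐c = cong₂ (λ x y → 𝟙 x + y) (b≐c F.zero) (countB-cong (b≐c ∘ F.suc))

countB-false : ∀ {k} {b : Fin k → Bool} → (∀ i → b i ≡ false) → countB b ≡ 0
countB-false {zero} _ = refl
countB-false {suc k} b≡false rewrite b≡false F.zero = countB-false (b≡false ∘ F.suc)

countB-mono : ∀ {k} {b c : Fin k → Bool} → b ⊆ᵇ c → countB b ≤ countB c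
countB-mono {zero} _ = z≤n
countB-mono {suc k} b⊆c = +-mono-≤ (𝟙-mono (b⊆c F.zero)) (countB-mono (b⊆c ∘ F.suc))

countB-mono-< : ∀ {k} {b c : Fin k → Bool} {i} → b ⊆ᵇ c → b i ≡ false → c i ≡ true → countB b < countB c
countB-mono-< {i = F.zero} b⊆c bi ci rewrite bi | ci = s≤s (countB-mono (b⊆c ∘ F.suc))
countB-mono-< {i = F.suc i} b⊆c bi ci = +-mono-≤-< (𝟙-mono (b⊆c F.zero)) (countB-mono-< (b⊆c ∘ F.suc) bi ci)

countB-pos : ∀ {k} {b : Fin k → Bool} {i} → b i ≡ true → 1 ≤ countB b
countB-pos {k} {b} bi =
  subst (_< countB b) (countB-false {k} λ _ → refl) (countB-mono-< {k} {λ _ → false} {b} (λ _ ()) refl bi)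

countB-update : ∀ {k} {b c : Fin k → Bool} i → (∀ j → j ≢ i → b j ≡ c j) →
  countB b + 𝟙 (c i) ≡ countB c + 𝟙 (b i)
countB-update {b = b} {c} F.zero b≐c
  rewrite countB-cong {b = b ∘ F.suc} {c ∘ F.suc} (λ j → b≐c (F.suc j) λ ()) =
  xy∙z≈zy∙x (𝟙 (b F.zero)) (countB (c ∘ F.suc)) (𝟙 (c F.zero))
countB-update {b = b} {c} (F.suc i) b≐c rewrite b≐c F.zero (λ ()) = begin
  (x + countB (b ∘ F.suc)) + 𝟙 (c (F.suc i))  ≡⟨ +-assoc x _ _ ⟩
  x + (countB (b ∘ F.suc) + 𝟙 (c (F.suc i)))  ≡⟨ cong (x +_) (countB-update i λ j j≢i →
                                                     b≐c (F.suc j) (j≢i ∘ suc-injective)) ⟩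
  x + (countB (c ∘ F.suc) + 𝟙 (b (F.suc i)))  ≡⟨ +-assoc x _ _ ⟨
  (x + countB (c ∘ F.suc)) + 𝟙 (b (F.suc i))  ∎
  where
  open ≡-Reasoning
  x = 𝟙 (c F.zero)

countB-remove : ∀ {k} {b : Fin k → Bool} {i} → b i ≡ true →
  countB b ≡ suc (countB (λ j → b j ∧ not ⌊ j ≟ i ⌋))
countB-remove {b = b} {i} bi = begin
  countB b              ≡⟨ +-identityʳ _ ⟨
  countB b + 𝟙 false    ≡⟨ cong ((countB b +_) ∘ 𝟙) removed ⟨
  countB b + 𝟙 (b′ i)   ≡⟨ countB-update i agree ⟨
  countB b′ + 𝟙 (b i)   ≡⟨ cong ((countB b′ +_) ∘ 𝟙) bi ⟩
  countB b′ + 1         ≡⟨ +-comm _ 1 ⟩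
  suc (countB b′)       ∎
  where
  open ≡-Reasoning
  b′ = λ j → b j ∧ not ⌊ j ≟ i ⌋
  removed : b′ i ≡ false
  removed rewrite ⌊⌋-yes (i ≟ i) refl = ∧-zeroʳ (b i)
  agree : ∀ j → j ≢ i → b′ j ≡ b j
  agree j j≢i rewrite ⌊⌋-no (j ≟ i) j≢i = ∧-identityʳ (b j)

countB-single : ∀ {k} (a : Fin k) → countB (λ v → ⌊ a ≟ v ⌋) ≡ 1
countB-single {k} a = begin
  countB (λ v → ⌊ a ≟ v ⌋)                ≡⟨ +-identityʳ _ ⟨
  countB (λ v → ⌊ a ≟ v ⌋) + 𝟙 false      ≡⟨ countB-update a (λ j j≢a → ⌊⌋-no (a ≟ j) (j≢a ∘ sym)) ⟩
  countB {k} (λ _ → false) + 𝟙 ⌊ a ≟ a ⌋  ≡⟨ cong₂ (λ z w → z + 𝟙 w) (countB-false {k} λ _ → refl)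
                                                                  (⌊⌋-yes (a ≟ a) refl) ⟩
  1                                       ∎
  where open ≡-Reasoning

countB-sum : ∀ {k} (b : Fin k → Bool) → countB b ≡ sum (𝟙 ∘ b)
countB-sum {zero} _ = refl
countB-sum {suc k} b = cong (𝟙 (b F.zero) +_) (countB-sum (b ∘ F.suc))

sum-ones : ∀ k → sum {k} (λ _ → 1) ≡ k
sum-ones zero = refl
sum-ones (suc k) = cong suc (sum-ones k)

subset-of-size : ∀ {k} (b : Fin k → Bool) {t} → t ≤ countB b →
  Σ (Fin k → Bool) λ c → c ⊆ᵇ b × countB c ≡ t
subset-of-size {zero} _ z≤n = (λ ()) , (λ ()) , refl
subset-of-size {suc k} b {t} t≤ with b F.zero in b₀ | t
... | false | t with subset-of-size (b ∘ F.suc) t≤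
...   | c , c⊆ , |c| = (false ∷ c) , (λ { F.zero () ; (F.suc i) → c⊆ i }) , |c|
subset-of-size {suc k} b t≤ | true | zero = (λ _ → false) , (λ _ ()) , countB-false {suc k} λ _ → refl
subset-of-size {suc k} b t≤ | true | suc t with subset-of-size (b ∘ F.suc) (s≤s⁻¹ t≤)
...   | c , c⊆ , |c| = (true ∷ c) , (λ { F.zero _ → b₀ ; (F.suc i) → c⊆ i }) , cong suc |c|

-- Parity

oddᵇ : ℕ → Bool
oddᵇ zero = false
oddᵇ (suc n) = not (oddᵇ n)

%2≡𝟙∘oddᵇ : ∀ n → n % 2 ≡ 𝟙 (oddᵇ n)
%2≡𝟙∘oddᵇ zero = refl
%2≡𝟙∘oddᵇ (suc zero) = refl
%2≡𝟙∘oddᵇ (suc (suc n)) rewrite not-involutive (oddᵇ n) = %2≡𝟙∘oddᵇ n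

-- OddN a and EvenN a are, definitionally, the left-hand sides at b = 1 and b = 0.
%2-≡⇔oddᵇ-≡ : ∀ a b → (a % 2 ≡ b % 2) ⇔ (oddᵇ a ≡ oddᵇ b)
%2-≡⇔oddᵇ-≡ a b rewrite %2≡𝟙∘oddᵇ a | %2≡𝟙∘oddᵇ b = mk⇔ 𝟙-injective (cong 𝟙)

oddᵇ-𝟙 : ∀ b → oddᵇ (𝟙 b) ≡ b
oddᵇ-𝟙 false = refl
oddᵇ-𝟙 true = refl

oddᵇ-+ : ∀ a b → oddᵇ (a + b) ≡ oddᵇ a xor oddᵇ b
oddᵇ-+ zero b = refl
oddᵇ-+ (suc a) b rewrite oddᵇ-+ a b = not-distribˡ-xor (oddᵇ a) (oddᵇ b)

xor-cancelˡ : ∀ a {b c} → a xor b ≡ a xor c → b ≡ c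
xor-cancelˡ false eq = eq
xor-cancelˡ true {b} {c} eq = trans (sym (not-involutive b)) (trans (cong not eq) (not-involutive c))

xor-≡-true : ∀ a b → (a xor b ≡ true) ⇔ (b ≡ not a)
xor-≡-true false false = mk⇔ (λ ()) (λ ())
xor-≡-true false true = mk⇔ (λ _ → refl) (λ _ → refl)
xor-≡-true true false = mk⇔ (λ _ → refl) (λ _ → refl)
xor-≡-true true true = mk⇔ (λ ()) (λ ())

oddᵇ-sum : ∀ {k} (f : Fin k → ℕ) → oddᵇ (sum f) ≡ oddᵇ (countB (oddᵇ ∘ f))
oddᵇ-sum {zero} _ = refl
oddᵇ-sum {suc k} f = begin
  oddᵇ (f₀ + sum (f ∘ F.suc))                              ≡⟨ oddᵇ-+ f₀ _ ⟩
  oddᵇ f₀ xor oddᵇ (sum (f ∘ F.suc))                       ≡⟨ cong₂ _xor_ (sym (oddᵇ-𝟙 (oddᵇ f₀)))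
                                                                             (oddᵇ-sum (f ∘ F.suc)) ⟩
  oddᵇ (𝟙 (oddᵇ f₀)) xor oddᵇ (countB (oddᵇ ∘ f ∘ F.suc))  ≡⟨ oddᵇ-+ (𝟙 (oddᵇ f₀)) _ ⟨
  oddᵇ (countB (oddᵇ ∘ f))                                 ∎
  where
  open ≡-Reasoning
  f₀ = f F.zero

countB-parity-except : ∀ {k} {b c : Fin k → Bool} i → (∀ j → j ≢ i → b j ≡ c j) →
  oddᵇ (countB b) ≡ oddᵇ (countB c) → b i ≡ c i
countB-parity-except {b = b} {c} i b≐c same = sym (xor-cancelˡ (oddᵇ (countB b)) (begin
  oddᵇ (countB b) xor c i              ≡⟨ cong (oddᵇ (countB b) xor_) (oddᵇ-𝟙 (c i)) ⟨
  oddᵇ (countB b) xor oddᵇ (𝟙 (c i))   ≡⟨ oddᵇ-+ (countB b) _ ⟨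
  oddᵇ (countB b + 𝟙 (c i))            ≡⟨ cong oddᵇ (countB-update i b≐c) ⟩
  oddᵇ (countB c + 𝟙 (b i))            ≡⟨ oddᵇ-+ (countB c) _ ⟩
  oddᵇ (countB c) xor oddᵇ (𝟙 (b i))   ≡⟨ cong₂ _xor_ (sym same) (oddᵇ-𝟙 (b i)) ⟩
  oddᵇ (countB b) xor b i              ∎))
  where open ≡-Reasoning

-- Dense sets of out-degrees

DenseUpTo : (ℕ → Bool) → ℕ → Set
DenseUpTo h d = ∀ i → i < d → h i ≡ false → h (suc i) ≡ true

Consecutive : (ℕ → Bool) → ℕ → Set
Consecutive h d = ∃ λ k → k < d × h k ≡ true × h (suc k) ≡ true

consecutive? : ∀ h d → Dec (Consecutive h d)
consecutive? h = anyUpTo? (λ k → (h k ≟ᵇ true) ×-dec (h (suc k) ≟ᵇ true))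

module _ {h : ℕ → Bool} {d : ℕ} (dense : DenseUpTo h d) where

  dense-down : ∀ {i} → suc i ≤ d → h (suc i) ≡ false → h i ≡ true
  dense-down {i} i<d hsi with h i in hi
  ... | true = refl
  ... | false with () ← trans (sym (dense i i<d hi)) hsi

  alternates : ¬ Consecutive h d → ∀ i → i ≤ d → h i ≡ h 0 xor oddᵇ i
  alternates _ zero _ = sym (xor-identityʳ (h 0))
  alternates ¬cons (suc i) i<d = begin
    h (suc i)              ≡⟨ next ⟩
    not (h i)              ≡⟨ cong not (alternates ¬cons i (<⇒≤ i<d)) ⟩
    not (h 0 xor oddᵇ i)   ≡⟨ not-distribʳ-xor (h 0) (oddᵇ i) ⟩
    h 0 xor oddᵇ (suc i)   ∎
    where
    open ≡-Reasoning
    next : h (suc i) ≡ not (h i)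
    next with h i in hi | h (suc i) in hsi
    ... | true | true = ⊥-elim (¬cons (i , i<d , hi , hsi))
    ... | true | false = refl
    ... | false | _ = trans (sym hsi) (dense i i<d hi)

  member⇔parity : ¬ Consecutive h d → ∀ {i} → i ≤ d → (h i ≡ true) ⇔ (oddᵇ i ≡ not (h 0))
  member⇔parity ¬cons {i} i≤d =
    subst (λ z → (z ≡ true) ⇔ (oddᵇ i ≡ not (h 0))) (sym (alternates ¬cons i i≤d))
      (xor-≡-true (h 0) (oddᵇ i))

fin-to-≤ : ∀ {d} {P : ℕ → Set} → (∀ (j : Fin (suc d)) → P (toℕ j)) → ∀ {i} → i ≤ d → P i
fin-to-≤ {P = P} all {i} i≤d = subst P (toℕ-fromℕ< (s≤s i≤d)) (all (fromℕ< (s≤s i≤d)))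

module _ (G : Graph) (H : Assignment G) (x : Fin (n G)) where

  odd-member : HOdd G H x → ∀ {i} → i ≤ deg G x → H x i ≡ true → oddᵇ i ≡ true
  odd-member (_ , odd) {i} i≤d hi =
    Equivalence.to (%2-≡⇔oddᵇ-≡ i 1) (fin-to-≤ {P = λ i → H x i ≡ true → OddN i} odd i≤d hi)

  even-member : HEven G H x → ∀ {i} → i ≤ deg G x → H x i ≡ true → oddᵇ i ≡ false
  even-member (_ , even) {i} i≤d hi =
    Equivalence.to (%2-≡⇔oddᵇ-≡ i 0) (fin-to-≤ {P = λ i → H x i ≡ true → EvenN i} even i≤d hi)

  fixedParity⇒¬consecutive : FixedParity G H x → ¬ Consecutive (H x) (deg G x)
  fixedParity⇒¬consecutive (inj₁ odd) (k , k<d , hk , hsk) =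
    case trans (sym (odd-member odd k<d hsk)) (cong not (odd-member odd (<⇒≤ k<d) hk)) of λ ()
  fixedParity⇒¬consecutive (inj₂ even) (k , k<d , hk , hsk) =
    case trans (sym (cong not (even-member even (<⇒≤ k<d) hk))) (even-member even k<d hsk) of λ ()

  module _ (dense : DenseUpTo (H x) (deg G x)) (deg≥1 : 1 ≤ deg G x)
           (¬cons : ¬ Consecutive (H x) (deg G x)) where

    private
      parity-of-member : (j : Fin (suc (deg G x))) → H x (toℕ j) ≡ true → oddᵇ (toℕ j) ≡ not (H x 0)
      parity-of-member j = Equivalence.to (member⇔parity dense ¬cons (toℕ≤pred[n] j))

    odd-if-0∉H : H x 0 ≡ false → HOdd G H x
    odd-if-0∉H h0 =
      (one , subst (λ i → H x i ≡ true) (sym (toℕ-fromℕ< (s≤s deg≥1))) one∈H) ,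
      λ j hj → Equivalence.from (%2-≡⇔oddᵇ-≡ (toℕ j) 1) (trans (parity-of-member j hj) (cong not h0))
      where
      one = fromℕ< (s≤s deg≥1)
      one∈H : H x 1 ≡ true
      one∈H = Equivalence.from (member⇔parity dense ¬cons deg≥1) (cong not (sym h0))

    even-if-0∈H : H x 0 ≡ true → HEven G H x
    even-if-0∈H h0 =
      (F.zero , h0) ,
      λ j hj → Equivalence.from (%2-≡⇔oddᵇ-≡ (toℕ j) 0) (trans (parity-of-member j hj) (cong not h0))

    fixedParity-if-¬consecutive : FixedParity G H x
    fixedParity-if-¬consecutive with H x 0 in h0
    ... | true = inj₂ (even-if-0∈H h0)
    ... | false = inj₁ (odd-if-0∉H h0)

    HOdd?-if-¬consecutive : ⌊ HOdd? G H x ⌋ ≡ not (H x 0)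
    HOdd?-if-¬consecutive = by-0∈H (H x 0) refl
      where
      by-0∈H : ∀ b → H x 0 ≡ b → ⌊ HOdd? G H x ⌋ ≡ not b
      by-0∈H true h0 = ⌊⌋-no (HOdd? G H x) λ odd → case proj₂ odd F.zero h0 of λ ()
      by-0∈H false h0 = ⌊⌋-yes (HOdd? G H x) (odd-if-0∉H h0)

  member⇔oddᵇ≡HOdd? : DenseUpTo (H x) (deg G x) → 1 ≤ deg G x → FixedParity G H x →
    ∀ {i} → i ≤ deg G x → (H x i ≡ true) ⇔ (oddᵇ i ≡ ⌊ HOdd? G H x ⌋)
  member⇔oddᵇ≡HOdd? dense deg≥1 fp {i} i≤d =
    subst (λ c → (H x i ≡ true) ⇔ (oddᵇ i ≡ c)) (sym (HOdd?-if-¬consecutive dense deg≥1 ¬cons))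
      (member⇔parity dense ¬cons i≤d)
    where ¬cons = fixedParity⇒¬consecutive fp

-- Orientations

δ : ∀ {k} → Fin k → Fin k → ℕ
δ u v = 𝟙 ⌊ u ≟ v ⌋

δ-refl : ∀ {k} (u : Fin k) → δ u u ≡ 1
δ-refl u = cong 𝟙 (⌊⌋-yes (u ≟ u) refl)

δ-≢ : ∀ {k} {u v : Fin k} → u ≢ v → δ u v ≡ 0
δ-≢ {u = u} {v} u≢v = cong 𝟙 (⌊⌋-no (u ≟ v) u≢v)

another : ∀ {k} → 2 ≤ k → (x : Fin k) → ∃ λ u → u ≢ x
another (s≤s (s≤s _)) F.zero = F.suc F.zero , λ ()
another (s≤s (s≤s _)) (F.suc _) = F.zero , λ ()

module _ (G : Graph) where

  end₁ end₂ : Fin (m G) → Fin (n G)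
  end₁ ed = proj₁ (ends G ed)
  end₂ ed = proj₂ (ends G ed)

  Endpoint : Fin (n G) → Fin (m G) → Set
  Endpoint v ed = v ≡ end₁ ed ⊎ v ≡ end₂ ed

  incident : Fin (n G) → Fin (m G) → Bool
  incident v ed = ⌊ end₁ ed ≟ v ⌋ ∨ ⌊ end₂ ed ≟ v ⌋

  endpoint⇒incident : ∀ {v ed} → Endpoint v ed → incident v ed ≡ true
  endpoint⇒incident {v} {ed} (inj₁ e) rewrite ⌊⌋-yes (end₁ ed ≟ v) (sym e) = refl
  endpoint⇒incident {v} {ed} (inj₂ e) rewrite ⌊⌋-yes (end₂ ed ≟ v) (sym e) = ∨-zeroʳ _

  head : Orientation G → Fin (m G) → Fin (n G)
  head O ed = if O ed then end₂ ed else end₁ ed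

  tail-endpoint : ∀ O ed → Endpoint (tail G O ed) ed
  tail-endpoint O ed with O ed
  ... | true = inj₁ refl
  ... | false = inj₂ refl

  head-endpoint : ∀ O ed → Endpoint (head O ed) ed
  head-endpoint O ed with O ed
  ... | true = inj₂ refl
  ... | false = inj₁ refl

  endpoint⇒tail⊎head : ∀ O {v ed} → Endpoint v ed → v ≡ tail G O ed ⊎ v ≡ head O ed
  endpoint⇒tail⊎head O {ed = ed} v-end with O ed | v-end
  ... | true | inj₁ e = inj₁ e
  ... | true | inj₂ e = inj₂ e
  ... | false | inj₁ e = inj₂ e
  ... | false | inj₂ e = inj₁ e

  tail≢head : ∀ O ed → tail G O ed ≢ head O ed
  tail≢head O ed with O ed
  ... | true = noLoop G ed
  ... | false = noLoop G ed ∘ sym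

  reverse : Orientation G → Fin (m G) → Orientation G
  reverse O ed = updateAt O ed not

  tail-reverse : ∀ O ed → tail G (reverse O ed) ed ≡ head O ed
  tail-reverse O ed rewrite updateAt-updates ed {not} O with O ed
  ... | true = refl
  ... | false = refl

  tail-reverse-other : ∀ O {ed ed′} → ed′ ≢ ed → tail G (reverse O ed) ed′ ≡ tail G O ed′
  tail-reverse-other O {ed} {ed′} ed′≢ed =
    cong (λ b → if b then end₁ ed′ else end₂ ed′) (updateAt-minimal ed′ ed O ed′≢ed)

  outdeg-reverse : ∀ O ed v → outdeg G (reverse O ed) v + δ (tail G O ed) v ≡ outdeg G O v + δ (head O ed) v
  outdeg-reverse O ed v =
    subst (λ z → outdeg G (reverse O ed) v + δ (tail G O ed) v ≡ outdeg G O v + δ z v) (tail-reverse O ed)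
      (countB-update ed λ ed′ ed′≢ed → cong (λ z → ⌊ z ≟ v ⌋) (tail-reverse-other O ed′≢ed))

  outdeg-reverse-other : ∀ O {ed v} → ¬ Endpoint v ed → outdeg G (reverse O ed) v ≡ outdeg G O v
  outdeg-reverse-other O {ed} {v} v∉ed = +-cancelʳ-≡ 0 _ _ (begin
    outdeg G (reverse O ed) v + 0                  ≡⟨ cong (outdeg G (reverse O ed) v +_) (not-at (tail-endpoint O ed)) ⟨
    outdeg G (reverse O ed) v + δ (tail G O ed) v  ≡⟨ outdeg-reverse O ed v ⟩
    outdeg G O v + δ (head O ed) v                 ≡⟨ cong (outdeg G O v +_) (not-at (head-endpoint O ed)) ⟩
    outdeg G O v + 0                               ∎)
    where
    open ≡-Reasoning
    not-at : ∀ {u} → Endpoint u ed → δ u v ≡ 0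
    not-at u-end = δ-≢ λ { refl → v∉ed u-end }

  outdeg-reverse-tail : ∀ O ed → suc (outdeg G (reverse O ed) (tail G O ed)) ≡ outdeg G O (tail G O ed)
  outdeg-reverse-tail O ed = begin
    suc (outdeg G (reverse O ed) t)      ≡⟨ +-comm 1 _ ⟩
    outdeg G (reverse O ed) t + 1        ≡⟨ cong (outdeg G (reverse O ed) t +_) (δ-refl t) ⟨
    outdeg G (reverse O ed) t + δ t t    ≡⟨ outdeg-reverse O ed t ⟩
    outdeg G O t + δ (head O ed) t       ≡⟨ cong (outdeg G O t +_) (δ-≢ (tail≢head O ed ∘ sym)) ⟩
    outdeg G O t + 0                     ≡⟨ +-identityʳ _ ⟩
    outdeg G O t                         ∎
    where
    open ≡-Reasoning
    t = tail G O ed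

  outdeg-reverse-head : ∀ O ed → outdeg G (reverse O ed) (head O ed) ≡ suc (outdeg G O (head O ed))
  outdeg-reverse-head O ed = begin
    outdeg G (reverse O ed) h                   ≡⟨ +-identityʳ _ ⟨
    outdeg G (reverse O ed) h + 0               ≡⟨ cong (outdeg G (reverse O ed) h +_) (δ-≢ (tail≢head O ed)) ⟨
    outdeg G (reverse O ed) h + δ (tail G O ed) h  ≡⟨ outdeg-reverse O ed h ⟩
    outdeg G O h + δ h h                        ≡⟨ cong (outdeg G O h +_) (δ-refl h) ⟩
    outdeg G O h + 1                            ≡⟨ +-comm _ 1 ⟩
    suc (outdeg G O h)                          ∎
    where
    open ≡-Reasoning
    h = head O ed

  outdeg≤deg : ∀ O v → outdeg G O v ≤ deg G v
  outdeg≤deg O v = countB-mono λ ed tail≡v →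
    endpoint⇒incident (subst (λ u → Endpoint u ed) (⌊⌋-sound (tail G O ed ≟ v) tail≡v) (tail-endpoint O ed))

  outdeg-sum : ∀ O → sum (outdeg G O) ≡ m G
  outdeg-sum O = begin
    sum (outdeg G O)                              ≡⟨ sum-cong-≗ (λ v → countB-sum λ ed → ⌊ tail G O ed ≟ v ⌋) ⟩
    sum (λ v → sum (λ ed → δ (tail G O ed) v))    ≡⟨ ∑-comm (λ v ed → δ (tail G O ed) v) ⟩
    sum (λ ed → sum (λ v → δ (tail G O ed) v))    ≡⟨ sum-cong-≗ single ⟩
    sum {m G} (λ _ → 1)                           ≡⟨ sum-ones (m G) ⟩
    m G                                           ∎
    where
    open ≡-Reasoning
    single : ∀ ed → sum (δ (tail G O ed)) ≡ 1
    single ed = trans (sym (countB-sum λ v → ⌊ tail G O ed ≟ v ⌋)) (countB-single (tail G O ed))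

  oddᵇ-edges : ∀ O → oddᵇ (m G) ≡ oddᵇ (countB (λ v → oddᵇ (outdeg G O v)))
  oddᵇ-edges O = trans (cong oddᵇ (sym (outdeg-sum O))) (oddᵇ-sum (outdeg G O))

  adjacent-endpointˡ : ∀ {u w} (a : Adjacent G u w) → Endpoint u (proj₁ a)
  adjacent-endpointˡ (_ , inj₁ e) = inj₁ (sym (cong proj₁ e))
  adjacent-endpointˡ (_ , inj₂ e) = inj₂ (sym (cong proj₂ e))

  adjacent-endpointʳ : ∀ {u w} (a : Adjacent G u w) → Endpoint w (proj₁ a)
  adjacent-endpointʳ (_ , inj₁ e) = inj₂ (sym (cong proj₂ e))
  adjacent-endpointʳ (_ , inj₂ e) = inj₁ (sym (cong proj₁ e))

  adjacent-endpoints : ∀ {u w v} (a : Adjacent G u w) → Endpoint v (proj₁ a) → v ≡ u ⊎ v ≡ w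
  adjacent-endpoints (_ , inj₁ e) (inj₁ v≡) = inj₁ (trans v≡ (cong proj₁ e))
  adjacent-endpoints (_ , inj₁ e) (inj₂ v≡) = inj₂ (trans v≡ (cong proj₂ e))
  adjacent-endpoints (_ , inj₂ e) (inj₁ v≡) = inj₂ (trans v≡ (cong proj₁ e))
  adjacent-endpoints (_ , inj₂ e) (inj₂ v≡) = inj₁ (trans v≡ (cong proj₂ e))

  adjacent⇒≢ : ∀ {u w} → Adjacent G u w → u ≢ w
  adjacent⇒≢ (ed , inj₁ e) refl = noLoop G ed (trans (cong proj₁ e) (sym (cong proj₂ e)))
  adjacent⇒≢ (ed , inj₂ e) refl = noLoop G ed (trans (cong proj₁ e) (sym (cong proj₂ e)))

  reach-start : ∀ {P u v} → Reach G P u v → P u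
  reach-start (here Pu) = Pu
  reach-start (step Pu _ _) = Pu

  neighbour : Connected G → 2 ≤ n G → ∀ x → Σ (Fin (n G)) (Adjacent G x)
  neighbour connected 2≤n x with another 2≤n x
  ... | u , u≢x = first-step (connected x u) u≢x
    where
    first-step : ∀ {u} → Reach G (λ _ → ⊤) x u → u ≢ x → Σ (Fin (n G)) (Adjacent G x)
    first-step (here _) u≢x = ⊥-elim (u≢x refl)
    first-step (step _ a _) _ = _ , a

  away : Fin (n G) → (Fin (m G) → Bool) → Orientation G
  away x S ed = if ⌊ end₁ ed ≟ x ⌋ then S ed else not (S ed)

  tail-away : ∀ x S ed → ⌊ tail G (away x S) ed ≟ x ⌋ ≡ incident x ed ∧ S ed
  tail-away x S ed with end₁ ed ≟ x | S ed
  ... | yes refl | true = ⌊⌋-yes (end₁ ed ≟ end₁ ed) refl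
  ... | yes refl | false = ⌊⌋-no (end₂ ed ≟ end₁ ed) (noLoop G ed ∘ sym)
  ... | no _ | true = sym (∧-identityʳ _)
  ... | no end₁≢x | false = trans (⌊⌋-no (end₁ ed ≟ x) end₁≢x) (sym (∧-zeroʳ _))

  outdeg-away : ∀ x {S} → S ⊆ᵇ incident x → outdeg G (away x S) x ≡ countB S
  outdeg-away x {S} S⊆ = countB-cong λ ed → trans (tail-away x S ed) (∧-⊆ (S⊆ ed))

-- Repairing an orientation

Satisfied : (G : Graph) → Assignment G → Orientation G → Fin (n G) → Set
Satisfied G H O v = H v (outdeg G O v) ≡ true

module _ (G : Graph) (H : Assignment G) (dense : ∀ v → DenseUpTo (H v) (deg G v)) where

  reverse-satisfies : ∀ O {ed v} → Endpoint G v ed → H v (outdeg G O v) ≡ false →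
    Satisfied G H (reverse G O ed) v
  reverse-satisfies O {ed} v-end unsat with endpoint⇒tail⊎head G O v-end
  ... | inj₁ refl = dense-down (dense t) (≤-trans (≤-reflexive fewer) (outdeg≤deg G O t))
                      (trans (cong (H t) fewer) unsat)
    where
    t = tail G O ed
    fewer = outdeg-reverse-tail G O ed
  ... | inj₂ refl = subst (λ z → H h z ≡ true) (sym more)
                      (dense h _ (≤-trans (≤-reflexive (sym more)) (outdeg≤deg G (reverse G O ed) h)) unsat)
    where
    h = head G O ed
    more = outdeg-reverse-head G O ed

  module Repair {P : Fin (n G) → Set} (P? : ∀ v → Dec (P v)) (root : Fin (n G))
    (connected : ∀ v → P v → Reach G P v root)
    (Inv : Orientation G → Set)
    (Inv-reverse : ∀ O ed → (∀ {v} → Endpoint G v ed → P v) → Inv O → Inv (reverse G O ed)) where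

    Bad : Orientation G → Fin (n G) → Set
    Bad O v = P v × v ≢ root × H v (outdeg G O v) ≡ false

    bad? : ∀ O v → Dec (Bad O v)
    bad? O v = P? v ×-dec ¬? (v ≟ root) ×-dec (H v (outdeg G O v) ≟ᵇ false)

    badCount : Orientation G → ℕ
    badCount O = countB (λ v → ⌊ bad? O v ⌋)

    Improvement : Orientation G → Fin (n G) → Set
    Improvement O w = Σ (Orientation G) λ O′ → Inv O′ × (∀ v → Bad O′ v → Bad O v) × ¬ Bad O′ w

    -- Reversing the first edge of a path from w to the root satisfies w; only the next vertex of
    -- the path can turn bad, and its defect is passed on along the rest of the path.
    improve : ∀ {w} → Reach G P w root → ∀ O → Inv O → Bad O w → Improvement O w
    improve (here _) _ _ (_ , w≢root , _) = ⊥-elim (w≢root refl)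
    improve {w} (step {w = w₁} Pw a rest) O inv (_ , _ , unsat) = extend continue
      where
      ed = proj₁ a
      O₁ = reverse G O ed

      inv₁ : Inv O₁
      inv₁ = Inv-reverse O ed (λ v-end → [ (λ { refl → Pw }) , (λ { refl → reach-start G rest }) ]
                                           (adjacent-endpoints G a v-end)) inv

      continue : Improvement O₁ w₁
      continue with bad? O₁ w₁
      ... | no ok = O₁ , inv₁ , (λ _ b → b) , ok
      ... | yes b = improve rest O₁ inv₁ b

      unchanged : ∀ {v} → v ≢ w → v ≢ w₁ → Bad O₁ v → Bad O v
      unchanged {v} v≢w v≢w₁ = subst (λ z → P v × v ≢ root × H v z ≡ false)
        (outdeg-reverse-other G O λ v-end → [ v≢w , v≢w₁ ] (adjacent-endpoints G a v-end))

      extend : Improvement O₁ w₁ → Improvement O w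
      extend (O′ , inv′ , fewer₁ , ok-w₁) = O′ , inv′ , fewer , ¬bad-w
        where
        ¬bad-w : ¬ Bad O′ w
        ¬bad-w b = case trans (sym (reverse-satisfies O (adjacent-endpointˡ G a) unsat))
                              (proj₂ (proj₂ (fewer₁ w b))) of λ ()
        fewer : ∀ v → Bad O′ v → Bad O v
        fewer v b with v ≟ w | v ≟ w₁
        ... | yes refl | _ = ⊥-elim (¬bad-w b)
        ... | no _ | yes refl = ⊥-elim (ok-w₁ b)
        ... | no v≢w | no v≢w₁ = unchanged v≢w v≢w₁ (fewer₁ v b)

    Repaired : Set
    Repaired = Σ (Orientation G) λ O → Inv O × (∀ v → P v → v ≢ root → Satisfied G H O v)

    repair : ∀ O → Inv O → Repaired
    repair O = go O (<-wellFounded (badCount O))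
      where
      go : ∀ O → Acc _<_ (badCount O) → Inv O → Repaired
      go O (acc smaller) inv with any? (bad? O)
      ... | no none = O , inv , λ v Pv v≢root → ¬-not λ unsat → none (v , Pv , v≢root , unsat)
      ... | yes (w , bad-w) with improve (connected w (proj₁ bad-w)) O inv bad-w
      ...   | O′ , inv′ , fewer , ¬bad-w = go O′ (smaller decreases) inv′
        where
        decreases : badCount O′ < badCount O
        decreases = countB-mono-< {i = w} (λ v b → ⌊⌋-yes (bad? O v) (fewer v (⌊⌋-sound (bad? O′ v) b)))
                      (⌊⌋-no (bad? O′ w) ¬bad-w) (⌊⌋-yes (bad? O w) bad-w)

-- H-orientations of 2-connected graphs

module _ (G : Graph) (H : Assignment G) (tc : TwoConnected G) (dn : Dense G H) where

  private
    dense : ∀ v → DenseUpTo (H v) (deg G v)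
    dense = proj₂ dn

    2≤n : 2 ≤ n G
    2≤n = ≤-trans (n≤1+n 2) (proj₁ tc)

  deg≥1 : ∀ x → 1 ≤ deg G x
  deg≥1 x = countB-pos {b = incident G x}
    (endpoint⇒incident G (adjacent-endpointˡ G (proj₂ (neighbour G (proj₁ dn) 2≤n x))))

  satisfied⇒oddᵇ≡HOdd? : ∀ O {v} → FixedParity G H v → Satisfied G H O v →
    oddᵇ (outdeg G O v) ≡ ⌊ HOdd? G H v ⌋
  satisfied⇒oddᵇ≡HOdd? O {v} fp =
    Equivalence.to (member⇔oddᵇ≡HOdd? G H v (dense v) (deg≥1 v) fp (outdeg≤deg G O v))

  numOdd≡edges-mod2 : (∀ x → FixedParity G H x) → Σ (Orientation G) (IsHOrientation G H) →
    numOdd G H % 2 ≡ e G % 2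
  numOdd≡edges-mod2 fp (O , sat) = Equivalence.from (%2-≡⇔oddᵇ-≡ (numOdd G H) (m G)) (begin
    oddᵇ (countB (λ v → ⌊ HOdd? G H v ⌋))      ≡⟨ cong oddᵇ (countB-cong λ v →
                                                    satisfied⇒oddᵇ≡HOdd? O (fp v) (sat v)) ⟨
    oddᵇ (countB (λ v → oddᵇ (outdeg G O v)))  ≡⟨ oddᵇ-edges G O ⟨
    oddᵇ (m G)                                 ∎)
    where open ≡-Reasoning

  orientation-if-parities-agree : (∀ x → FixedParity G H x) → numOdd G H % 2 ≡ e G % 2 →
    Σ (Orientation G) (IsHOrientation G H)
  orientation-if-parities-agree fp agree = O , satisfied
    where
    root : Fin (n G)
    root = fromℕ< (≤-trans (s≤s z≤n) 2≤n)

    open Repair G H dense (λ _ → yes tt) root (λ v _ → proj₁ dn v root) (λ _ → ⊤) (λ _ _ _ _ → tt)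

    repaired = repair (λ _ → true) tt
    O = proj₁ repaired

    satisfied-off-root : ∀ v → v ≢ root → Satisfied G H O v
    satisfied-off-root v = proj₂ (proj₂ repaired) v tt

    root-parity : oddᵇ (outdeg G O root) ≡ ⌊ HOdd? G H root ⌋
    root-parity = countB-parity-except root
      (λ v v≢root → satisfied⇒oddᵇ≡HOdd? O (fp v) (satisfied-off-root v v≢root))
      (trans (sym (oddᵇ-edges G O)) (sym (Equivalence.to (%2-≡⇔oddᵇ-≡ (numOdd G H) (m G)) agree)))

    satisfied : IsHOrientation G H O
    satisfied v with v ≟ root
    ... | yes refl = Equivalence.from
                       (member⇔oddᵇ≡HOdd? G H root (dense root) (deg≥1 root) (fp root) (outdeg≤deg G O root))
                       root-parity
    ... | no v≢root = satisfied-off-root v v≢root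

  orientation-if-consecutive : ∀ x → Consecutive (H x) (deg G x) → Σ (Orientation G) (IsHOrientation G H)
  orientation-if-consecutive x (k , k<d , k∈H , k+1∈H) = finish _ refl
    where
    y = proj₁ (neighbour G (proj₁ dn) 2≤n x)
    xy = proj₂ (neighbour G (proj₁ dn) 2≤n x)
    f = proj₁ xy

    others : Fin (m G) → Bool
    others ed = incident G x ed ∧ not ⌊ ed ≟ f ⌋

    S-spec : Σ (Fin (m G) → Bool) λ S → S ⊆ᵇ others × countB S ≡ k
    S-spec = subset-of-size others (s≤s⁻¹ (subst (k <_) deg≡1+others k<d))
      where deg≡1+others = countB-remove {b = incident G x} (endpoint⇒incident G (adjacent-endpointˡ G xy))

    S = proj₁ S-spec

    Inv : Orientation G → Set
    Inv O = outdeg G O x ≡ k + δ (tail G O f) x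

    inv₀ : Inv (away G x S)
    inv₀ = begin
      outdeg G (away G x S) x        ≡⟨ outdeg-away G x (λ ed → ∧-conicalˡ _ _ ∘ proj₁ (proj₂ S-spec) ed) ⟩
      countB S                       ≡⟨ proj₂ (proj₂ S-spec) ⟩
      k                              ≡⟨ +-identityʳ k ⟨
      k + 0                          ≡⟨ cong ((k +_) ∘ 𝟙) f-in ⟨
      k + δ (tail G (away G x S) f) x  ∎
      where
      open ≡-Reasoning
      f∉S : S f ≢ true
      f∉S f∈S = case trans (sym (proj₁ (proj₂ S-spec) f f∈S)) f∉others of λ ()
        where
        f∉others : others f ≡ false
        f∉others = trans (cong (λ b → incident G x f ∧ not b) (⌊⌋-yes (f ≟ f) refl)) (∧-zeroʳ _)
      f-in : ⌊ tail G (away G x S) f ≟ x ⌋ ≡ false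
      f-in = trans (tail-away G x S f) (trans (cong (incident G x f ∧_) (¬-not f∉S)) (∧-zeroʳ _))

    Inv-reverse : ∀ O ed → (∀ {v} → Endpoint G v ed → v ≢ x) → Inv O → Inv (reverse G O ed)
    Inv-reverse O ed ends≢x inv = begin
      outdeg G (reverse G O ed) x          ≡⟨ outdeg-reverse-other G O (λ x-end → ends≢x x-end refl) ⟩
      outdeg G O x                         ≡⟨ inv ⟩
      k + δ (tail G O f) x                 ≡⟨ cong (λ z → k + δ z x) (tail-reverse-other G O f≢ed) ⟨
      k + δ (tail G (reverse G O ed) f) x  ∎
      where
      open ≡-Reasoning
      f≢ed : f ≢ ed
      f≢ed refl = ends≢x (adjacent-endpointˡ G xy) refl

    Inv-reverse-f : ∀ O → Inv O → Inv (reverse G O f)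
    Inv-reverse-f O inv = +-cancelʳ-≡ t _ _ (begin
      outdeg G (reverse G O f) x + t              ≡⟨ outdeg-reverse G O f x ⟩
      outdeg G O x + h                            ≡⟨ cong (_+ h) inv ⟩
      (k + t) + h                                 ≡⟨ xy∙z≈xz∙y k t h ⟩
      (k + h) + t                                 ≡⟨ cong (λ z → (k + δ z x) + t) (tail-reverse G O f) ⟨
      (k + δ (tail G (reverse G O f) f) x) + t    ∎)
      where
      open ≡-Reasoning
      t = δ (tail G O f) x
      h = δ (head G O f) x

    open Repair G H dense (λ v → ¬? (v ≟ x)) y (λ v v≢x → proj₂ tc x v y v≢x (adjacent⇒≢ G xy ∘ sym))
      Inv Inv-reverse

    repaired = repair (away G x S) inv₀

    O₁ : Orientation G
    O₁ = proj₁ repaired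

    inv₁ : Inv O₁
    inv₁ = proj₁ (proj₂ repaired)

    sat₁ : ∀ v → v ≢ x → v ≢ y → Satisfied G H O₁ v
    sat₁ = proj₂ (proj₂ repaired)

    -- k and k + 1 both lie in H(x), so x is satisfied whichever way f points.
    x-satisfied : ∀ O → Inv O → Satisfied G H O x
    x-satisfied O inv = subst (λ z → H x z ≡ true) (sym inv) (by-f ⌊ tail G O f ≟ x ⌋)
      where
      by-f : ∀ b → H x (k + 𝟙 b) ≡ true
      by-f false = subst (λ z → H x z ≡ true) (sym (+-identityʳ k)) k∈H
      by-f true = subst (λ z → H x z ≡ true) (+-comm 1 k) k+1∈H

    satisfied-everywhere : ∀ O → Inv O → Satisfied G H O y → (∀ v → v ≢ x → v ≢ y → Satisfied G H O v) →
      IsHOrientation G H O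
    satisfied-everywhere O inv sat-y sat-rest v with v ≟ x | v ≟ y
    ... | yes refl | _ = x-satisfied O inv
    ... | no _ | yes refl = sat-y
    ... | no v≢x | no v≢y = sat-rest v v≢x v≢y

    finish : ∀ b → H y (outdeg G O₁ y) ≡ b → Σ (Orientation G) (IsHOrientation G H)
    finish true y-satisfied = O₁ , satisfied-everywhere O₁ inv₁ y-satisfied sat₁
    finish false y-unsatisfied = reverse G O₁ f ,
      satisfied-everywhere (reverse G O₁ f) (Inv-reverse-f O₁ inv₁)
        (reverse-satisfies G H dense O₁ (adjacent-endpointʳ G xy) y-unsatisfied)
        λ v v≢x v≢y → subst (λ z → H v z ≡ true)
          (sym (outdeg-reverse-other G O₁ λ v-end → [ v≢x , v≢y ] (adjacent-endpoints G xy v-end)))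
          (sat₁ v v≢x v≢y)

  consecutive-or-fixedParity : ∀ x → Consecutive (H x) (deg G x) ⊎ FixedParity G H x
  consecutive-or-fixedParity x with consecutive? (H x) (deg G x)
  ... | yes cons = inj₁ cons
  ... | no ¬cons = inj₂ (fixedParity-if-¬consecutive G H x (dense x) (deg≥1 x) ¬cons)

theorem2p5 : (G : Graph) (H : Assignment G) → TwoConnected G → Dense G H →
    (¬ (Σ (Orientation G) (IsHOrientation G H)))
      ⇔ ((∀ x → FixedParity G H x) × (numOdd G H % 2 ≢ e G % 2))
theorem2p5 G H tc dn = mk⇔ necessary sufficient
  where
  necessary : ¬ Σ (Orientation G) (IsHOrientation G H) →
    (∀ x → FixedParity G H x) × (numOdd G H % 2 ≢ e G % 2)
  necessary none = fixed , λ agree → none (orientation-if-parities-agree G H tc dn fixed agree)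
    where
    fixed : ∀ x → FixedParity G H x
    fixed x = [ (λ cons → ⊥-elim (none (orientation-if-consecutive G H tc dn x cons))) , id ]
                (consecutive-or-fixedParity G H tc dn x)

  sufficient : (∀ x → FixedParity G H x) × (numOdd G H % 2 ≢ e G % 2) →
    ¬ Σ (Orientation G) (IsHOrientation G H)
  sufficient (fixed , disagree) orientation = disagree (numOdd≡edges-mod2 G H tc dn fixed orientation)
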